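{- Let \(\Pi\) be a derivation in the system \(\mathrm{HA}+\mathrm{EM}_1\) described in the context, and let \(\mathfrak{a}_0, \dotsc, \mathfrak{a}_n\) be a principal branch of \(\Pi\) in open normal form, with associated numbers \(n_E, n_A, n_I\). Let \(A_0, \dotsc, A_n\) be the formulas of which \(\mathfrak{a}_0, \dotsc, \mathfrak{a}_n\) are occurrences. Then: (1) \(A_i\) is a non-atomic subformula of \(A_n\) for all \(n_E + n_A < i \leq n\); (2) if some \(\mathfrak{a}_i\) is the conclusion of an introduction rule instance, then \(A_i\) is a subformula of \(A_n\). Moreover, assume that \(A_n\) is a simple formula. Then: (3) if a term variable \(x\) is free in some \(A_i\), then \(x\) is free in \(\Pi\); (4) if some \(A_i\) is simply universal, then \(\mathfrak{a}_i\) is the premiss of a \(\forall\)-elimination rule instance; (5) if \(\Pi\) has no free term variables and \(A_i\) is simply universal, then \(A_{i+1}\) is a closed atomic formula.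
   Context: The system \(\mathrm{HA}+\mathrm{EM}_1\) is a natural deduction system for first-order Heyting arithmetic. Language: variables for natural numbers, a function symbol for every primitive recursive function (including \(0\) and successor \(S\)), the equality predicate, and the \(0\)-ary predicate \(\bot\) (never true); \(\neg A\) abbreviates \(A \to \bot\). Terms are reduced by the defining equations of the primitive recursive functions oriented left to right; this is strongly normalizing with unique normal forms, closed normal terms are numerals \(S^n(0)\), and formulas are identified when they have the same normal form. Rules: the usual introduction and elimination rule for each of \(\land, \lor, \to, \forall, \exists\) (minimal logic, with discharge of assumptions); atomic rules, i.e. a recursive, sound set of rules whose premisses and conclusion are atomic, which do not discharge assumptions nor bind variables, containing the equality rules, ex falso \(\bot / P\) for atomic \(P\), \(S(x)=0/\bot\), \(S(x)=S(y)/x=y\), and, for every closed atomic \(P\), the axiom \(/P\) if \(P\) is true and the rule \(P/\bot\) if \(P\) is false; the induction rule Ind: from \(A[0/x]\) and a derivation of \(A[S(x)/x]\) from the discharged assumption \(A\), conclude \(A[t/x]\) (\(t\) is the main term); and the rule \(\mathrm{EM}_1\): for an atomic formula \(P\), from a derivation of \(C\) from the discharged assumption \(\forall x P\) (the universal assumption) and a derivation of \(C\) from the discharged assumption \(\neg P[y/x]\) (the existential assumption), where \(y\) does not occur in \(C\) nor in open assumptions other than \(\neg P[y/x]\), conclude \(C\). Ind and \(\mathrm{EM}_1\) are counted as neither introduction nor elimination rules. In an elimination rule the major premiss is the one containing the eliminated connective/quantifier, displayed leftmost; for \(\mathrm{EM}_1\) the leftmost premiss is the major one. Derivations are trees of formula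 occurrences. A rule instance binds a term variable as follows: \(\forall\)I binds its quantified variable in the derivation of its premiss; \(\exists\)E binds its eigenvariable in the derivation of its rightmost premiss; Ind binds \(x\) in the derivation of its rightmost premiss; \(\mathrm{EM}_1\) binds \(y\) in the derivation of its rightmost premiss. A term variable is free in a derivation if it occurs free in some formula occurrence and is not bound by any rule instance. A branch of a derivation \(\Pi\) is a sequence of formula occurrences \(\mathfrak{a}_0,\dotsc,\mathfrak{a}_n\) such that \(\mathfrak{a}_0\) is an assumption or the conclusion of an atomic axiom, \(\mathfrak{a}_i\) is a premiss and \(\mathfrak{a}_{i+1}\) the conclusion of one rule instance, and \(\mathfrak{a}_n\) is the conclusion of \(\Pi\). It is principal if whenever \(\mathfrak{a}_i\) is a premiss of an elimination or \(\mathrm{EM}_1\) rule instance, it is its major (leftmost) premiss. A principal branch \(\mathfrak{a}_0,\dotsc,\mathfrak{a}_n\) is in open normal form if there are natural numbers \(n_E,n_A,n_I\) with \(n_E+n_A+n_I=n\) such that: \(\mathfrak{a}_0\) is an open assumption of \(\Pi\); \(\mathfrak{a}_i\) is the conclusion of an elimination rule instance for \(0<i\le n_E\); \(\mathfrak{a}_i\) is the conclusion of an atomic or \(\mathrm{EM}_1\) rule instance for \(n_E<i\le n_E+n_A\); \(\mathfrak{a}_{n_E+n_A+1}\) is the conclusion of an introduction rule instance; and \(\mathfrak{a}_i\) is the conclusion of an introduction or \(\mathrm{EM}_1\) rule instance for \(n_E+n_A<i\le n\). A formula is simply existential (resp. simply universal) if it is \(\exists x P\) (resp. \(\forall x P\))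 with \(P\) atomic; it is simple if it is closed and either atomic or simply existential. -}

module Defs where

-- Formulas use a locally-nameless representation: free term variables are
-- named by natural numbers, bound variables are well-scoped de Bruijn
-- indices (Fin n).  Hence alpha-equivalent formulas are syntactically equal.

open import Data.Nat using (ℕ; zero; suc; _+_; _<_; _≤_; _≟_)
open import Data.Fin using (Fin; zero; suc)
open import Data.Vec using (Vec; []; _∷_; lookup)
import Data.Vec as Vec
open import Data.List using (List; []; _∷_)
import Data.List as List
open import Data.List.Relation.Unary.All using (All)
open import Data.List.Relation.Binary.Pointwise using (Pointwise)
open import Relation.Binary.Construct.Closure.ReflexiveTransitive using (Star)
open import Data.Product using (Σ; _×_; _,_)
open import Data.Sum using (_⊎_)
open import Data.Empty using (⊥)
open import Data.Unit using (⊤)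
open import Relation.Nullary using (¬_; Dec; yes; no)
open import Relation.Binary.PropositionalEquality using (_≡_; _≢_)

-- Primitive recursive function symbols (one for every primitive
-- recursive definition), indexed by arity.

data PR : ℕ → Set where
  zer  : PR 0
  succ : PR 1
  proj : ∀ {k} → Fin k → PR k
  comp : ∀ {k m} → PR m → Vec (PR k) m → PR k
  rec  : ∀ {k} → PR k → PR (suc (suc k)) → PR (suc k)

data Term (n : ℕ) : Set where
  var  : ℕ → Term n
  bvar : Fin n → Term n
  app  : ∀ {k} → PR k → Vec (Term n) k → Term n

0̂ : ∀ {n} → Term n
0̂ = app zer []

Ŝ : ∀ {n} → Term n → Term n
Ŝ t = app succ (t ∷ [])

infix 7 _≐_
infixr 6 _∧'_
infixr 5 _∨'_
infixr 4 _⇒'_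

data Fm (n : ℕ) : Set where
  _≐_  : Term n → Term n → Fm n
  ⊥'   : Fm n
  _∧'_ : Fm n → Fm n → Fm n
  _∨'_ : Fm n → Fm n → Fm n
  _⇒'_ : Fm n → Fm n → Fm n
  ∀'   : Fm (suc n) → Fm n
  ∃'   : Fm (suc n) → Fm n

¬' : ∀ {n} → Fm n → Fm n
¬' A = A ⇒' ⊥'

data Atomic {n : ℕ} : Fm n → Set where
  at-eq  : ∀ {t u} → Atomic (t ≐ u)
  at-bot : Atomic ⊥'

mutual
  renT : ∀ {m k} → (Fin m → Fin k) → Term m → Term k
  renT ρ (var x)    = var x
  renT ρ (bvar i)   = bvar (ρ i)
  renT ρ (app f ts) = app f (renTs ρ ts)

  renTs : ∀ {m k j} → (Fin m → Fin k) → Vec (Term m) j → Vec (Term k) j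
  renTs ρ []       = []
  renTs ρ (t ∷ ts) = renT ρ t ∷ renTs ρ ts

mutual
  subT : ∀ {m k} → (Fin m → Term k) → Term m → Term k
  subT σ (var x)    = var x
  subT σ (bvar i)   = σ i
  subT σ (app f ts) = app f (subTs σ ts)

  subTs : ∀ {m k j} → (Fin m → Term k) → Vec (Term m) j → Vec (Term k) j
  subTs σ []       = []
  subTs σ (t ∷ ts) = subT σ t ∷ subTs σ ts

liftσ : ∀ {m k} → (Fin m → Term k) → Fin (suc m) → Term (suc k)
liftσ σ zero    = bvar zero
liftσ σ (suc i) = renT suc (σ i)

subF : ∀ {m k} → (Fin m → Term k) → Fm m → Fm k
subF σ (t ≐ u)  = subT σ t ≐ subT σ u
subF σ ⊥'       = ⊥'
subF σ (A ∧' B) = subF σ A ∧' subF σ B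
subF σ (A ∨' B) = subF σ A ∨' subF σ B
subF σ (A ⇒' B) = subF σ A ⇒' subF σ B
subF σ (∀' A)   = ∀' (subF (liftσ σ) A)
subF σ (∃' A)   = ∃' (subF (liftσ σ) A)

inst : Fm 1 → Term 0 → Fm 0
inst A t = subF (λ _ → t) A

emb : ∀ {n} → Term 0 → Term n
emb = renT (λ ())

mutual
  fsubT : ∀ {n} → ℕ → Term 0 → Term n → Term n
  fsubT x t (var y) with x ≟ y
  ... | yes _ = emb t
  ... | no  _ = var y
  fsubT x t (bvar i)   = bvar i
  fsubT x t (app f ts) = app f (fsubTs x t ts)

  fsubTs : ∀ {n j} → ℕ → Term 0 → Vec (Term n) j → Vec (Term n) j
  fsubTs x t []       = []
  fsubTs x t (u ∷ us) = fsubT x t u ∷ fsubTs x t us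

fsubF : ∀ {n} → ℕ → Term 0 → Fm n → Fm n
fsubF x t (u ≐ v)  = fsubT x t u ≐ fsubT x t v
fsubF x t ⊥'       = ⊥'
fsubF x t (A ∧' B) = fsubF x t A ∧' fsubF x t B
fsubF x t (A ∨' B) = fsubF x t A ∨' fsubF x t B
fsubF x t (A ⇒' B) = fsubF x t A ⇒' fsubF x t B
fsubF x t (∀' A)   = ∀' (fsubF x t A)
fsubF x t (∃' A)   = ∃' (fsubF x t A)

mutual
  data OccT (x : ℕ) {n : ℕ} : Term n → Set where
    o-var : OccT x (var x)
    o-app : ∀ {k} {f : PR k} {ts} → OccTs x ts → OccT x (app f ts)

  data OccTs (x : ℕ) {n : ℕ} : ∀ {k} → Vec (Term n) k → Set where
    o-here  : ∀ {k t} {ts : Vec (Term n) k} → OccT x t → OccTs x (t ∷ ts)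
    o-there : ∀ {k t} {ts : Vec (Term n) k} → OccTs x ts → OccTs x (t ∷ ts)

data OccF (x : ℕ) {n : ℕ} : Fm n → Set where
  o-≐l : ∀ {t u} → OccT x t → OccF x (t ≐ u)
  o-≐r : ∀ {t u} → OccT x u → OccF x (t ≐ u)
  o-∧l : ∀ {A B} → OccF x A → OccF x (A ∧' B)
  o-∧r : ∀ {A B} → OccF x B → OccF x (A ∧' B)
  o-∨l : ∀ {A B} → OccF x A → OccF x (A ∨' B)
  o-∨r : ∀ {A B} → OccF x B → OccF x (A ∨' B)
  o-⇒l : ∀ {A B} → OccF x A → OccF x (A ⇒' B)
  o-⇒r : ∀ {A B} → OccF x B → OccF x (A ⇒' B)
  o-∀  : ∀ {A} → OccF x A → OccF x (∀' A)
  o-∃  : ∀ {A} → OccF x A → OccF x (∃' A)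

Closed : ∀ {n} → Fm n → Set
Closed A = ∀ x → ¬ OccF x A

SimplyUniversal : Fm 0 → Set
SimplyUniversal A = Σ (Fm 1) λ P → Atomic P × A ≡ ∀' P

SimplyExistential : Fm 0 → Set
SimplyExistential A = Σ (Fm 1) λ P → Atomic P × A ≡ ∃' P

Simple : Fm 0 → Set
Simple A = Closed A × (Atomic A ⊎ SimplyExistential A)

-- Term reduction: defining equations oriented left to right, closed
-- under contexts.  Formulas are identified when they have the same
-- normal form (relation _≈_).

appAll : ∀ {n k m} → Vec (PR k) m → Vec (Term n) k → Vec (Term n) m
appAll gs ts = Vec.map (λ g → app g ts) gs

mutual
  data _⟶T_ {n : ℕ} : Term n → Term n → Set where
    r-proj : ∀ {k} (i : Fin k) (ts : Vec (Term n) k) →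
             app (proj i) ts ⟶T lookup ts i
    r-comp : ∀ {k m} (f : PR m) (gs : Vec (PR k) m) (ts : Vec (Term n) k) →
             app (comp f gs) ts ⟶T app f (appAll gs ts)
    r-rec0 : ∀ {k} (g : PR k) (h : PR (suc (suc k))) (ts : Vec (Term n) k) →
             app (rec g h) (0̂ ∷ ts) ⟶T app g ts
    r-recS : ∀ {k} (g : PR k) (h : PR (suc (suc k))) (t : Term n) (ts : Vec (Term n) k) →
             app (rec g h) (Ŝ t ∷ ts) ⟶T app h (t ∷ app (rec g h) (t ∷ ts) ∷ ts)
    r-app  : ∀ {k} (f : PR k) {ts us : Vec (Term n) k} →
             ts ⟶Ts us → app f ts ⟶T app f us

  data _⟶Ts_ {n : ℕ} : ∀ {k} → Vec (Term n) k → Vec (Term n) k → Set where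
    r-here  : ∀ {k t u} {ts : Vec (Term n) k} → t ⟶T u → (t ∷ ts) ⟶Ts (u ∷ ts)
    r-there : ∀ {k t} {ts us : Vec (Term n) k} → ts ⟶Ts us → (t ∷ ts) ⟶Ts (t ∷ us)

data _⟶F_ {n : ℕ} : Fm n → Fm n → Set where
  r-≐l : ∀ {t t' u} → t ⟶T t' → (t ≐ u) ⟶F (t' ≐ u)
  r-≐r : ∀ {t u u'} → u ⟶T u' → (t ≐ u) ⟶F (t ≐ u')
  r-∧l : ∀ {A A' B} → A ⟶F A' → (A ∧' B) ⟶F (A' ∧' B)
  r-∧r : ∀ {A B B'} → B ⟶F B' → (A ∧' B) ⟶F (A ∧' B')
  r-∨l : ∀ {A A' B} → A ⟶F A' → (A ∨' B) ⟶F (A' ∨' B)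
  r-∨r : ∀ {A B B'} → B ⟶F B' → (A ∨' B) ⟶F (A ∨' B')
  r-⇒l : ∀ {A A' B} → A ⟶F A' → (A ⇒' B) ⟶F (A' ⇒' B)
  r-⇒r : ∀ {A B B'} → B ⟶F B' → (A ⇒' B) ⟶F (A ⇒' B')
  r-∀  : ∀ {A A'} → A ⟶F A' → ∀' A ⟶F ∀' A'
  r-∃  : ∀ {A A'} → A ⟶F A' → ∃' A ⟶F ∃' A'

NormalF : ∀ {n} → Fm n → Set
NormalF {n} C = ∀ (C' : Fm n) → ¬ (C ⟶F C')

infix 3 _≈_
_≈_ : ∀ {n} → Fm n → Fm n → Set
_≈_ {n} A B = Σ (Fm n) λ C → Star _⟶F_ A C × Star _⟶F_ B C × NormalF C

-- Subformulas (Gentzen/Prawitz sense, including instances A[t/x] of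
-- quantified formulas), up to the identification _≈_.
-- B ⊑ A  :  B is a subformula of A.

infix 3 _⊑_
data _⊑_ : Fm 0 → Fm 0 → Set where
  ⊑-refl : ∀ {A B} → B ≈ A → B ⊑ A
  ⊑-∧l   : ∀ {A₁ A₂ B} → B ⊑ A₁ → B ⊑ (A₁ ∧' A₂)
  ⊑-∧r   : ∀ {A₁ A₂ B} → B ⊑ A₂ → B ⊑ (A₁ ∧' A₂)
  ⊑-∨l   : ∀ {A₁ A₂ B} → B ⊑ A₁ → B ⊑ (A₁ ∨' A₂)
  ⊑-∨r   : ∀ {A₁ A₂ B} → B ⊑ A₂ → B ⊑ (A₁ ∨' A₂)
  ⊑-⇒l   : ∀ {A₁ A₂ B} → B ⊑ A₁ → B ⊑ (A₁ ⇒' A₂)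
  ⊑-⇒r   : ∀ {A₁ A₂ B} → B ⊑ A₂ → B ⊑ (A₁ ⇒' A₂)
  ⊑-∀    : ∀ {A B} (t : Term 0) → B ⊑ inst A t → B ⊑ ∀' A
  ⊑-∃    : ∀ {A B} (t : Term 0) → B ⊑ inst A t → B ⊑ ∃' A

mutual
  evalPR : ∀ {k} → PR k → Vec ℕ k → ℕ
  evalPR zer         []       = 0
  evalPR succ        (x ∷ []) = suc x
  evalPR (proj i)    xs       = lookup xs i
  evalPR (comp f gs) xs       = evalPR f (evalPRs gs xs)
  evalPR (rec g h)   (x ∷ xs) = recAux g h xs x

  evalPRs : ∀ {k m} → Vec (PR k) m → Vec ℕ k → Vec ℕ m
  evalPRs []       xs = []
  evalPRs (g ∷ gs) xs = evalPR g xs ∷ evalPRs gs xs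

  recAux : ∀ {k} → PR k → PR (suc (suc k)) → Vec ℕ k → ℕ → ℕ
  recAux g h xs zero    = evalPR g xs
  recAux g h xs (suc x) = evalPR h (x ∷ recAux g h xs x ∷ xs)

mutual
  evalT : Term 0 → (ℕ → ℕ) → ℕ
  evalT (var x)    ρ = ρ x
  evalT (bvar ())  ρ
  evalT (app f ts) ρ = evalPR f (evalTs ts ρ)

  evalTs : ∀ {k} → Vec (Term 0) k → (ℕ → ℕ) → Vec ℕ k
  evalTs []       ρ = []
  evalTs (t ∷ ts) ρ = evalT t ρ ∷ evalTs ts ρ

-- truth of an atomic formula under an assignment ρ of the free variables
-- (only used for atomic formulas; compound formulas are mapped to ⊥)
Holds : (ℕ → ℕ) → Fm 0 → Set
Holds ρ (t ≐ u) = evalT t ρ ≡ evalT u ρ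
Holds ρ _       = ⊥

-- truth of a closed atomic formula
True : Fm 0 → Set
True P = Holds (λ _ → 0) P

record AtomicRules : Set₁ where
  field
    Rule      : List (Fm 0) → Fm 0 → Set
    atomic    : ∀ Ps C → Rule Ps C → All Atomic Ps × Atomic C
    recursive : ∀ Ps C → Dec (Rule Ps C)
    sound     : ∀ Ps C → Rule Ps C → ∀ (ρ : ℕ → ℕ) → All (Holds ρ) Ps → Holds ρ C
    eq-refl   : ∀ t → Rule [] (t ≐ t)
    eq-sym    : ∀ t u → Rule (t ≐ u ∷ []) (u ≐ t)
    eq-trans  : ∀ t u v → Rule (t ≐ u ∷ u ≐ v ∷ []) (t ≐ v)
    eq-subst  : ∀ t u x P → Atomic P →
                Rule (t ≐ u ∷ fsubF x t P ∷ []) (fsubF x u P)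
    exfalso   : ∀ P → Atomic P → Rule (⊥' ∷ []) P
    succ≢0    : ∀ t → Rule (Ŝ t ≐ 0̂ ∷ []) ⊥'
    succ-inj  : ∀ t u → Rule (Ŝ t ≐ Ŝ u ∷ []) (t ≐ u)
    true-ax   : ∀ P → Atomic P → Closed P → True P → Rule [] P
    false-ru  : ∀ P → Atomic P → Closed P → ¬ True P → Rule (P ∷ []) ⊥'

-- Every node carries the
-- formula it is an occurrence of, the rule instance it is the conclusion
-- of (with discharge labels and bound variables), and its premisses
-- (in left-to-right order; the major premiss is the leftmost one).

data Tag : Set where
  hypT  : (label : ℕ) → Tag
  atomT : Tag
  andI andE₁ andE₂ orI₁ orI₂ impE allE exI : Tag
  orE   : (l₁ l₂ : ℕ) → Tag                          -- discharges l₁ in 2nd, l₂ in 3rd premiss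
  impI  : (l : ℕ) → Tag
  allI  : (x : ℕ) → Tag
  exE   : (l : ℕ) (y : ℕ) → Tag                      -- discharges l, eigenvariable y
  ind   : (l : ℕ) (x : ℕ) → Tag                      -- discharges l, induction variable x
  em1   : (l₁ l₂ : ℕ) (y : ℕ) → Tag                  -- universal/existential assumption labels, variable y

data Der : Set where
  node : Fm 0 → Tag → List Der → Der

concl : Der → Fm 0
concl (node F _ _) = F

tag : Der → Tag
tag (node _ τ _) = τ

-- ChildAt k d e : e is the k-th premiss (0 = leftmost) of the last rule of d
data ChildAt : ℕ → Der → Der → Set where
  c-here  : ∀ {F τ d ds} → ChildAt 0 (node F τ (d ∷ ds)) d
  c-there : ∀ {k F τ d d' ds} → ChildAt k (node F τ ds) d →
            ChildAt (suc k) (node F τ (d' ∷ ds)) d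

Discharges : Tag → ℕ → ℕ → Set
Discharges (impI l)       0 l' = l' ≡ l
Discharges (orE l₁ l₂)    1 l' = l' ≡ l₁
Discharges (orE l₁ l₂)    2 l' = l' ≡ l₂
Discharges (exE l y)      1 l' = l' ≡ l
Discharges (ind l x)      1 l' = l' ≡ l
Discharges (em1 l₁ l₂ y)  0 l' = l' ≡ l₁
Discharges (em1 l₁ l₂ y)  1 l' = l' ≡ l₂
Discharges _              _ _  = ⊥

Binds : Tag → ℕ → ℕ → Set
Binds (allI x)      0 x' = x' ≡ x
Binds (exE l y)     1 x' = x' ≡ y
Binds (ind l x)     1 x' = x' ≡ x
Binds (em1 l₁ l₂ y) 1 x' = x' ≡ y
Binds _             _ _  = ⊥

data OpenHyp (l : ℕ) (A : Fm 0) : Der → Set where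
  oh-here  : OpenHyp l A (node A (hypT l) [])
  oh-there : ∀ {k d e} → ChildAt k d e → OpenHyp l A e →
             ¬ Discharges (tag d) k l → OpenHyp l A d

Disch : ℕ → Fm 0 → Der → Set
Disch l A d = ∀ B → OpenHyp l B d → B ≈ A

NotInOpen : ℕ → Der → Set
NotInOpen x d = ∀ l B → OpenHyp l B d → ¬ OccF x B

NotInOpenExcept : ℕ → ℕ → Der → Set
NotInOpenExcept x l d = ∀ l' B → OpenHyp l' B d → l' ≢ l → ¬ OccF x B

data FreeIn (x : ℕ) : Der → Set where
  fi-here  : ∀ {d} → OccF x (concl d) → FreeIn x d
  fi-there : ∀ {k d e} → ChildAt k d e → FreeIn x e →
             ¬ Binds (tag d) k x → FreeIn x d

RuleOK : AtomicRules → Fm 0 → Tag → List Der → Set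
RuleOK R F (hypT l) [] = ⊤
RuleOK R F atomT ds =
  Σ (List (Fm 0)) λ Ps → Σ (Fm 0) λ C →
    AtomicRules.Rule R Ps C × F ≈ C × Pointwise _≈_ (List.map concl ds) Ps
RuleOK R F andI (d₁ ∷ d₂ ∷ []) = F ≈ concl d₁ ∧' concl d₂
RuleOK R F andE₁ (d ∷ []) = Σ (Fm 0) λ B → concl d ≈ F ∧' B
RuleOK R F andE₂ (d ∷ []) = Σ (Fm 0) λ A → concl d ≈ A ∧' F
RuleOK R F orI₁ (d ∷ []) = Σ (Fm 0) λ B → F ≈ concl d ∨' B
RuleOK R F orI₂ (d ∷ []) = Σ (Fm 0) λ A → F ≈ A ∨' concl d
RuleOK R F (orE l₁ l₂) (d₀ ∷ d₁ ∷ d₂ ∷ []) =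
  Σ (Fm 0) λ A → Σ (Fm 0) λ B →
    concl d₀ ≈ A ∨' B × Disch l₁ A d₁ × Disch l₂ B d₂ ×
    concl d₁ ≈ F × concl d₂ ≈ F
RuleOK R F (impI l) (d ∷ []) =
  Σ (Fm 0) λ A → F ≈ A ⇒' concl d × Disch l A d
RuleOK R F impE (d₀ ∷ d₁ ∷ []) = concl d₀ ≈ concl d₁ ⇒' F
RuleOK R F (allI x) (d ∷ []) =
  Σ (Fm 1) λ A → F ≈ ∀' A × concl d ≈ inst A (var x) × ¬ OccF x A ×
    NotInOpen x d
RuleOK R F allE (d ∷ []) =
  Σ (Fm 1) λ A → Σ (Term 0) λ t → concl d ≈ ∀' A × F ≈ inst A t
RuleOK R F exI (d ∷ []) =
  Σ (Fm 1) λ A → Σ (Term 0) λ t → F ≈ ∃' A × concl d ≈ inst A t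
RuleOK R F (exE l y) (d₀ ∷ d₁ ∷ []) =
  Σ (Fm 1) λ A → concl d₀ ≈ ∃' A × Disch l (inst A (var y)) d₁ ×
    concl d₁ ≈ F × ¬ OccF y A × ¬ OccF y F × NotInOpenExcept y l d₁
RuleOK R F (ind l x) (d₀ ∷ d₁ ∷ []) =
  Σ (Fm 0) λ A → Σ (Term 0) λ t →
    concl d₀ ≈ fsubF x 0̂ A × Disch l A d₁ ×
    concl d₁ ≈ fsubF x (Ŝ (var x)) A × F ≈ fsubF x t A ×
    NotInOpenExcept x l d₁
RuleOK R F (em1 l₁ l₂ y) (d₀ ∷ d₁ ∷ []) =
  Σ (Fm 1) λ P → Atomic P ×
    Disch l₁ (∀' P) d₀ × Disch l₂ (¬' (inst P (var y))) d₁ ×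
    concl d₀ ≈ F × concl d₁ ≈ F × ¬ OccF y F × NotInOpenExcept y l₂ d₁
RuleOK R F _ _ = ⊥

data Valid (R : AtomicRules) : Der → Set where
  valid : ∀ {F τ ds} → All (Valid R) ds → RuleOK R F τ ds → Valid R (node F τ ds)

IsIntro : Tag → Set
IsIntro andI     = ⊤
IsIntro orI₁     = ⊤
IsIntro orI₂     = ⊤
IsIntro (impI _) = ⊤
IsIntro (allI _) = ⊤
IsIntro exI      = ⊤
IsIntro _        = ⊥

IsElim : Tag → Set
IsElim andE₁     = ⊤
IsElim andE₂     = ⊤
IsElim (orE _ _) = ⊤
IsElim impE      = ⊤
IsElim allE      = ⊤
IsElim (exE _ _) = ⊤
IsElim _         = ⊥

IsEM1 : Tag → Set
IsEM1 (em1 _ _ _) = ⊤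
IsEM1 _           = ⊥

IsAtomicRule : Tag → Set
IsAtomicRule atomT = ⊤
IsAtomicRule _     = ⊥

data Leaf : Der → Set where
  leaf-hyp : ∀ {A l} → Leaf (node A (hypT l) [])
  leaf-ax  : ∀ {A}   → Leaf (node A atomT [])

-- Branches a_0, …, a_n of Π.  occ i is the subderivation of Π whose
-- conclusion is the occurrence a_i; a_i is the (idx i)-th premiss of
-- the rule instance whose conclusion is a_(i+1).

record Branch (Π : Der) : Set where
  field
    len  : ℕ
    occ  : ℕ → Der                -- a_i (only i ≤ n is relevant)
    idx  : ℕ → ℕ
    link : ∀ i → i < len → ChildAt (idx i) (occ (suc i)) (occ i)
    top  : Leaf (occ 0)
    root : occ len ≡ Π

  fml : ℕ → Fm 0
  fml i = concl (occ i)

open Branch public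

Principal : ∀ {Π} → Branch Π → Set
Principal b = ∀ i → i < len b →
  (IsElim (tag (occ b (suc i))) ⊎ IsEM1 (tag (occ b (suc i)))) → idx b i ≡ 0

OpenAssumption : ∀ {Π} → Branch Π → Set
OpenAssumption b =
  Σ ℕ λ l → Σ (Fm 0) λ A → occ b 0 ≡ node A (hypT l) [] ×
    (∀ i → i < len b → ¬ Discharges (tag (occ b (suc i))) (idx b i) l)

OpenNormalForm : ∀ {Π} → Branch Π → ℕ → ℕ → ℕ → Set
OpenNormalForm b nE nA nI =
  nE + nA + nI ≡ len b ×
  OpenAssumption b ×
  (∀ i → 0 < i → i ≤ nE → IsElim (tag (occ b i))) ×
  (∀ i → nE < i → i ≤ nE + nA →
     IsAtomicRule (tag (occ b i)) ⊎ IsEM1 (tag (occ b i))) ×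
  (suc (nE + nA) ≤ len b → IsIntro (tag (occ b (suc (nE + nA))))) ×
  (∀ i → nE + nA < i → i ≤ len b →
     IsIntro (tag (occ b i)) ⊎ IsEM1 (tag (occ b i)))

-- Term reduction is confluent (by Takahashi's complete developments), so _≈_ is an
-- equivalence relation and the subformula relation is invariant under it.
-- Above its elimination and atomic parts, an open normal branch consists of conclusions
-- of introductions, which only enlarge formulas, and of EM1, which keeps them; hence
-- these formulas are non-atomic subformulas of A_n.  If A_n is simple, they are all
-- simply existential up to ≈, so each introduction there is ∃I and binds no variable;
-- elimination and EM1 rules are passed through their major premiss, where they bind
-- nothing either, so the free variables of the branch stay free in Π.  Going down from
-- A_n, a simply universal formula survives neither an atomic rule nor an introduction
-- (both have atomic premisses here) nor EM1, so it lies in the elimination part and is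
-- the major premiss of ∀E, whose conclusion is an atomic instance.

module Submission where

open import Data.Empty using (⊥; ⊥-elim)
open import Data.Fin using (Fin; zero; suc)
open import Data.List using ([]; _∷_)
import Data.List as List
open import Data.List.Relation.Binary.Pointwise using (Pointwise; _∷_)
open import Data.List.Relation.Unary.All using (All; _∷_)
open import Data.Nat using (ℕ; zero; suc; _+_; _<_; _≤_; _≤′_; _≤‴_; z≤n; s≤s; _≤?_; ≤′-refl; ≤′-step; ≤‴-refl; ≤‴-step)
open import Data.Nat.Properties using (≤-refl; ≤-trans; <-≤-trans; <⇒≤; ≤⇒≯; ≰⇒>; m≤m+n; m≤n⇒m≤1+n; m<n⇒m<1+n; ≤⇒≤′; ≤′⇒≤; ≤⇒≤‴; ≤‴⇒≤)
open import Data.Product using (Σ; _×_; _,_; proj₁; proj₂)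
open import Data.Sum using (_⊎_; inj₁; inj₂; [_,_]′)
open import Data.Unit using (⊤)
open import Data.Vec using (Vec; []; _∷_; lookup)
open import Defs
open import Function using (_∘_)
open import Relation.Binary.Construct.Closure.ReflexiveTransitive using (Star; ε; _◅_; _◅◅_; gmap; map; _⋆)
open import Relation.Binary.PropositionalEquality using (_≡_; refl; sym; trans; cong; subst)
open import Relation.Binary.Rewriting using (Confluent)
open import Relation.Nullary using (¬_; yes; no)

module _ {A : Set} {_▷_ : A → A → Set} (dev : A → A)
         (triangle : ∀ {x y} → x ▷ y → y ▷ dev x) where

  private
    strip : ∀ {x y z} → x ▷ y → Star _▷_ x z → Σ A λ w → Star _▷_ y w × z ▷ w
    strip {y = y} p ε = y , ε , p
    strip p (q ◅ qs) with strip (triangle q) qs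
    ... | w , s , r = w , triangle p ◅ s , r

  triangle⇒confluent : Confluent _▷_
  triangle⇒confluent ε qs = _ , qs , ε
  triangle⇒confluent (p ◅ ps) qs with strip p qs
  ... | _ , s , r with triangle⇒confluent ps s
  ... | w , a , b = w , a , r ◅ b

confluent-between : ∀ {A : Set} {_⟶_ _▷_ : A → A → Set} →
  (∀ {x y} → x ⟶ y → x ▷ y) → (∀ {x y} → x ▷ y → Star _⟶_ x y) →
  Confluent _▷_ → Confluent _⟶_
confluent-between ⟶⊆▷ ▷⊆⟶* conf ps qs with conf (map ⟶⊆▷ ps) (map ⟶⊆▷ qs)
... | w , a , b = w , (▷⊆⟶* ⋆) a , (▷⊆⟶* ⋆) b

mutual
  data _⇛_ {n : ℕ} : Term n → Term n → Set where
    p-var  : ∀ {x} → var x ⇛ var x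
    p-bvar : ∀ {i} → bvar i ⇛ bvar i
    p-app  : ∀ {k} {f : PR k} {ts us} → ts ⇛ˢ us → app f ts ⇛ app f us
    p-proj : ∀ {k} {i : Fin k} {ts us} → ts ⇛ˢ us → app (proj i) ts ⇛ lookup us i
    p-comp : ∀ {k m} {f : PR m} {gs : Vec (PR k) m} {ts us} → ts ⇛ˢ us →
             app (comp f gs) ts ⇛ app f (appAll gs us)
    p-rec0 : ∀ {k} {g : PR k} {h} {ts us} → ts ⇛ˢ us →
             app (rec g h) (0̂ ∷ ts) ⇛ app g us
    p-recS : ∀ {k} {g : PR k} {h} {t u ts us} → t ⇛ u → ts ⇛ˢ us →
             app (rec g h) (Ŝ t ∷ ts) ⇛ app h (u ∷ app (rec g h) (u ∷ us) ∷ us)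

  data _⇛ˢ_ {n : ℕ} : ∀ {k} → Vec (Term n) k → Vec (Term n) k → Set where
    []  : [] ⇛ˢ []
    _∷_ : ∀ {k t u} {ts us : Vec (Term n) k} → t ⇛ u → ts ⇛ˢ us → (t ∷ ts) ⇛ˢ (u ∷ us)

mutual
  ⇛-refl : ∀ {n} (t : Term n) → t ⇛ t
  ⇛-refl (var x)    = p-var
  ⇛-refl (bvar i)   = p-bvar
  ⇛-refl (app f ts) = p-app (⇛ˢ-refl ts)

  ⇛ˢ-refl : ∀ {n k} (ts : Vec (Term n) k) → ts ⇛ˢ ts
  ⇛ˢ-refl []       = []
  ⇛ˢ-refl (t ∷ ts) = ⇛-refl t ∷ ⇛ˢ-refl ts

mutual
  ⟶T⇒⇛ : ∀ {n} {t u : Term n} → t ⟶T u → t ⇛ u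
  ⟶T⇒⇛ (r-proj i ts)     = p-proj (⇛ˢ-refl ts)
  ⟶T⇒⇛ (r-comp f gs ts)  = p-comp (⇛ˢ-refl ts)
  ⟶T⇒⇛ (r-rec0 g h ts)   = p-rec0 (⇛ˢ-refl ts)
  ⟶T⇒⇛ (r-recS g h t ts) = p-recS (⇛-refl t) (⇛ˢ-refl ts)
  ⟶T⇒⇛ (r-app f rs)      = p-app (⟶Ts⇒⇛ˢ rs)

  ⟶Ts⇒⇛ˢ : ∀ {n k} {ts us : Vec (Term n) k} → ts ⟶Ts us → ts ⇛ˢ us
  ⟶Ts⇒⇛ˢ (r-here {ts = ts} r)  = ⟶T⇒⇛ r ∷ ⇛ˢ-refl ts
  ⟶Ts⇒⇛ˢ (r-there {t = t} rs) = ⇛-refl t ∷ ⟶Ts⇒⇛ˢ rs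

_⟶T*_ : ∀ {n} → Term n → Term n → Set
_⟶T*_ = Star _⟶T_

_⟶Ts*_ : ∀ {n k} → Vec (Term n) k → Vec (Term n) k → Set
_⟶Ts*_ = Star _⟶Ts_

mutual
  ⇛⇒⟶T* : ∀ {n} {t u : Term n} → t ⇛ u → t ⟶T* u
  ⇛⇒⟶T* p-var  = ε
  ⇛⇒⟶T* p-bvar = ε
  ⇛⇒⟶T* (p-app {f = f} ps) = gmap (app f) (r-app f) (⇛ˢ⇒⟶Ts* ps)
  ⇛⇒⟶T* (p-proj {i = i} {us = us} ps) =
    gmap (app (proj i)) (r-app (proj i)) (⇛ˢ⇒⟶Ts* ps) ◅◅ r-proj i us ◅ ε
  ⇛⇒⟶T* (p-comp {f = f} {gs = gs} {us = us} ps) =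
    gmap (app (comp f gs)) (r-app (comp f gs)) (⇛ˢ⇒⟶Ts* ps) ◅◅ r-comp f gs us ◅ ε
  ⇛⇒⟶T* (p-rec0 {g = g} {h = h} {us = us} ps) =
    gmap (λ vs → app (rec g h) (0̂ ∷ vs)) (r-app (rec g h) ∘ r-there) (⇛ˢ⇒⟶Ts* ps)
    ◅◅ r-rec0 g h us ◅ ε
  ⇛⇒⟶T* (p-recS {g = g} {h = h} {u = u} {ts = ts} {us = us} p ps) =
    gmap (λ v → app (rec g h) (Ŝ v ∷ ts)) (r-app (rec g h) ∘ r-here ∘ r-app succ ∘ r-here) (⇛⇒⟶T* p)
    ◅◅ gmap (λ vs → app (rec g h) (Ŝ u ∷ vs)) (r-app (rec g h) ∘ r-there) (⇛ˢ⇒⟶Ts* ps)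
    ◅◅ r-recS g h u us ◅ ε

  ⇛ˢ⇒⟶Ts* : ∀ {n k} {ts us : Vec (Term n) k} → ts ⇛ˢ us → ts ⟶Ts* us
  ⇛ˢ⇒⟶Ts* [] = ε
  ⇛ˢ⇒⟶Ts* (_∷_ {u = u} {ts = ts} p ps) =
    gmap (_∷ ts) r-here (⇛⇒⟶T* p) ◅◅ gmap (u ∷_) r-there (⇛ˢ⇒⟶Ts* ps)

mutual
  dev : ∀ {n} → Term n → Term n
  dev (var x)                  = var x
  dev (bvar i)                 = bvar i
  dev (app zer [])             = app zer []
  dev (app succ (t ∷ []))      = app succ (dev t ∷ [])
  dev (app (proj i) ts)        = lookup (devs ts) i
  dev (app (comp f gs) ts)     = app f (appAll gs (devs ts))
  dev (app (rec g h) (t ∷ ts)) = devRec g h t ts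

  -- rec g h (t ∷ ts) is a redex exactly when t is 0̂ or Ŝ s
  devRec : ∀ {n k} → PR k → PR (suc (suc k)) → Term n → Vec (Term n) k → Term n
  devRec g h (app zer [])         ts = app g (devs ts)
  devRec g h (app succ (s ∷ []))  ts = app h (dev s ∷ app (rec g h) (dev s ∷ devs ts) ∷ devs ts)
  devRec g h (var x)              ts = app (rec g h) (var x ∷ devs ts)
  devRec g h (bvar i)             ts = app (rec g h) (bvar i ∷ devs ts)
  devRec g h (app (proj i) us)    ts = app (rec g h) (dev (app (proj i) us) ∷ devs ts)
  devRec g h (app (comp f gs) us) ts = app (rec g h) (dev (app (comp f gs) us) ∷ devs ts)
  devRec g h (app (rec g' h') us) ts = app (rec g h) (dev (app (rec g' h') us) ∷ devs ts)

  devs : ∀ {n k} → Vec (Term n) k → Vec (Term n) k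
  devs []       = []
  devs (t ∷ ts) = dev t ∷ devs ts

lookup-⇛ˢ : ∀ {n k} {ts us : Vec (Term n) k} (i : Fin k) → ts ⇛ˢ us → lookup ts i ⇛ lookup us i
lookup-⇛ˢ zero    (p ∷ ps) = p
lookup-⇛ˢ (suc i) (p ∷ ps) = lookup-⇛ˢ i ps

appAll-⇛ˢ : ∀ {n k m} (gs : Vec (PR k) m) {ts us : Vec (Term n) k} →
  ts ⇛ˢ us → appAll gs ts ⇛ˢ appAll gs us
appAll-⇛ˢ []       ps = []
appAll-⇛ˢ (g ∷ gs) ps = p-app ps ∷ appAll-⇛ˢ gs ps

mutual
  ⇛-dev : ∀ {n} {t u : Term n} → t ⇛ u → u ⇛ dev t
  ⇛-dev p-var  = p-var
  ⇛-dev p-bvar = p-bvar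
  ⇛-dev (p-app {f = zer} [])              = p-app []
  ⇛-dev (p-app {f = succ} (p ∷ []))       = p-app (⇛-dev p ∷ [])
  ⇛-dev (p-app {f = proj i} ps)           = p-proj (⇛ˢ-devs ps)
  ⇛-dev (p-app {f = comp f gs} ps)        = p-comp (⇛ˢ-devs ps)
  ⇛-dev (p-app {f = rec g h} (p ∷ ps))    = ⇛-devRec p ps
  ⇛-dev (p-proj {i = i} ps)               = lookup-⇛ˢ i (⇛ˢ-devs ps)
  ⇛-dev (p-comp {gs = gs} ps)             = p-app (appAll-⇛ˢ gs (⇛ˢ-devs ps))
  ⇛-dev (p-rec0 ps)                       = p-app (⇛ˢ-devs ps)
  ⇛-dev (p-recS p ps)                     = p-app (⇛-dev p ∷ p-app (⇛-dev p ∷ ⇛ˢ-devs ps) ∷ ⇛ˢ-devs ps)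

  ⇛-devRec : ∀ {n k} {g : PR k} {h : PR (suc (suc k))} {t u : Term n} {ts us} →
    t ⇛ u → ts ⇛ˢ us → app (rec g h) (u ∷ us) ⇛ devRec g h t ts
  ⇛-devRec {t = app zer []}         (p-app [])       ps = p-rec0 (⇛ˢ-devs ps)
  ⇛-devRec {t = app succ (s ∷ [])}  (p-app (q ∷ [])) ps = p-recS (⇛-dev q) (⇛ˢ-devs ps)
  ⇛-devRec {t = var x}              p ps = p-app (⇛-dev p ∷ ⇛ˢ-devs ps)
  ⇛-devRec {t = bvar i}             p ps = p-app (⇛-dev p ∷ ⇛ˢ-devs ps)
  ⇛-devRec {t = app (proj i) us}    p ps = p-app (⇛-dev p ∷ ⇛ˢ-devs ps)
  ⇛-devRec {t = app (comp f gs) us} p ps = p-app (⇛-dev p ∷ ⇛ˢ-devs ps)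
  ⇛-devRec {t = app (rec g' h') us} p ps = p-app (⇛-dev p ∷ ⇛ˢ-devs ps)

  ⇛ˢ-devs : ∀ {n k} {ts us : Vec (Term n) k} → ts ⇛ˢ us → us ⇛ˢ devs ts
  ⇛ˢ-devs []       = []
  ⇛ˢ-devs (p ∷ ps) = ⇛-dev p ∷ ⇛ˢ-devs ps

data _⇛F_ {n : ℕ} : Fm n → Fm n → Set where
  q-≐ : ∀ {t t' u u'} → t ⇛ t' → u ⇛ u' → (t ≐ u) ⇛F (t' ≐ u')
  q-⊥ : ⊥' ⇛F ⊥'
  q-∧ : ∀ {A A' B B'} → A ⇛F A' → B ⇛F B' → (A ∧' B) ⇛F (A' ∧' B')
  q-∨ : ∀ {A A' B B'} → A ⇛F A' → B ⇛F B' → (A ∨' B) ⇛F (A' ∨' B')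
  q-⇒ : ∀ {A A' B B'} → A ⇛F A' → B ⇛F B' → (A ⇒' B) ⇛F (A' ⇒' B')
  q-∀ : ∀ {A A'} → A ⇛F A' → ∀' A ⇛F ∀' A'
  q-∃ : ∀ {A A'} → A ⇛F A' → ∃' A ⇛F ∃' A'

⇛F-refl : ∀ {n} (A : Fm n) → A ⇛F A
⇛F-refl (t ≐ u)  = q-≐ (⇛-refl t) (⇛-refl u)
⇛F-refl ⊥'       = q-⊥
⇛F-refl (A ∧' B) = q-∧ (⇛F-refl A) (⇛F-refl B)
⇛F-refl (A ∨' B) = q-∨ (⇛F-refl A) (⇛F-refl B)
⇛F-refl (A ⇒' B) = q-⇒ (⇛F-refl A) (⇛F-refl B)
⇛F-refl (∀' A)   = q-∀ (⇛F-refl A)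
⇛F-refl (∃' A)   = q-∃ (⇛F-refl A)

⟶F⇒⇛F : ∀ {n} {A B : Fm n} → A ⟶F B → A ⇛F B
⟶F⇒⇛F (r-≐l {u = u} r) = q-≐ (⟶T⇒⇛ r) (⇛-refl u)
⟶F⇒⇛F (r-≐r {t = t} r) = q-≐ (⇛-refl t) (⟶T⇒⇛ r)
⟶F⇒⇛F (r-∧l {B = B} r) = q-∧ (⟶F⇒⇛F r) (⇛F-refl B)
⟶F⇒⇛F (r-∧r {A = A} r) = q-∧ (⇛F-refl A) (⟶F⇒⇛F r)
⟶F⇒⇛F (r-∨l {B = B} r) = q-∨ (⟶F⇒⇛F r) (⇛F-refl B)
⟶F⇒⇛F (r-∨r {A = A} r) = q-∨ (⇛F-refl A) (⟶F⇒⇛F r)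
⟶F⇒⇛F (r-⇒l {B = B} r) = q-⇒ (⟶F⇒⇛F r) (⇛F-refl B)
⟶F⇒⇛F (r-⇒r {A = A} r) = q-⇒ (⇛F-refl A) (⟶F⇒⇛F r)
⟶F⇒⇛F (r-∀ r)          = q-∀ (⟶F⇒⇛F r)
⟶F⇒⇛F (r-∃ r)          = q-∃ (⟶F⇒⇛F r)

_⟶F*_ : ∀ {n} → Fm n → Fm n → Set
_⟶F*_ = Star _⟶F_

⇛F⇒⟶F* : ∀ {n} {A B : Fm n} → A ⇛F B → A ⟶F* B
⇛F⇒⟶F* (q-≐ {t' = t'} {u = u} p q) = gmap (_≐ u) r-≐l (⇛⇒⟶T* p) ◅◅ gmap (t' ≐_) r-≐r (⇛⇒⟶T* q)
⇛F⇒⟶F* q-⊥ = ε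
⇛F⇒⟶F* (q-∧ {A' = A'} {B = B} p q) = gmap (_∧' B) r-∧l (⇛F⇒⟶F* p) ◅◅ gmap (A' ∧'_) r-∧r (⇛F⇒⟶F* q)
⇛F⇒⟶F* (q-∨ {A' = A'} {B = B} p q) = gmap (_∨' B) r-∨l (⇛F⇒⟶F* p) ◅◅ gmap (A' ∨'_) r-∨r (⇛F⇒⟶F* q)
⇛F⇒⟶F* (q-⇒ {A' = A'} {B = B} p q) = gmap (_⇒' B) r-⇒l (⇛F⇒⟶F* p) ◅◅ gmap (A' ⇒'_) r-⇒r (⇛F⇒⟶F* q)
⇛F⇒⟶F* (q-∀ p) = gmap ∀' r-∀ (⇛F⇒⟶F* p)
⇛F⇒⟶F* (q-∃ p) = gmap ∃' r-∃ (⇛F⇒⟶F* p)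

devF : ∀ {n} → Fm n → Fm n
devF (t ≐ u)  = dev t ≐ dev u
devF ⊥'       = ⊥'
devF (A ∧' B) = devF A ∧' devF B
devF (A ∨' B) = devF A ∨' devF B
devF (A ⇒' B) = devF A ⇒' devF B
devF (∀' A)   = ∀' (devF A)
devF (∃' A)   = ∃' (devF A)

⇛F-devF : ∀ {n} {A B : Fm n} → A ⇛F B → B ⇛F devF A
⇛F-devF (q-≐ p q) = q-≐ (⇛-dev p) (⇛-dev q)
⇛F-devF q-⊥       = q-⊥
⇛F-devF (q-∧ p q) = q-∧ (⇛F-devF p) (⇛F-devF q)
⇛F-devF (q-∨ p q) = q-∨ (⇛F-devF p) (⇛F-devF q)
⇛F-devF (q-⇒ p q) = q-⇒ (⇛F-devF p) (⇛F-devF q)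
⇛F-devF (q-∀ p)   = q-∀ (⇛F-devF p)
⇛F-devF (q-∃ p)   = q-∃ (⇛F-devF p)

⟶F-confluent : ∀ {n} → Confluent (_⟶F_ {n})
⟶F-confluent = confluent-between ⟶F⇒⇛F ⇛F⇒⟶F* (triangle⇒confluent devF ⇛F-devF)

NormalF-irreducible : ∀ {n} {C D : Fm n} → NormalF C → C ⟶F* D → C ≡ D
NormalF-irreducible nC ε       = refl
NormalF-irreducible nC (r ◅ _) = ⊥-elim (nC _ r)

reduct-reaches-normal : ∀ {n} {X Y C : Fm n} → NormalF C → X ⟶F* C → X ⟶F* Y → Y ⟶F* C
reduct-reaches-normal nC s s' with ⟶F-confluent s s'
... | _ , c , y with NormalF-irreducible nC c
... | refl = y

≈-sym : ∀ {n} {A B : Fm n} → A ≈ B → B ≈ A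
≈-sym (C , a , b , nC) = C , b , a , nC

≈-trans : ∀ {n} {A B D : Fm n} → A ≈ B → B ≈ D → A ≈ D
≈-trans (C , a , b , nC) (C' , b' , d , nC') with NormalF-irreducible nC' (reduct-reaches-normal nC b b')
... | refl = C , a , d , nC

Normalizable : ∀ {n} → Fm n → Set
Normalizable {n} A = Σ (Fm n) λ C → A ⟶F* C × NormalF C

≈-normalizableˡ : ∀ {n} {A B : Fm n} → A ≈ B → Normalizable A
≈-normalizableˡ (C , a , _ , nC) = C , a , nC

≈-normalizableʳ : ∀ {n} {A B : Fm n} → A ≈ B → Normalizable B
≈-normalizableʳ = ≈-normalizableˡ ∘ ≈-sym

normalizable⇒≈-refl : ∀ {n} {A : Fm n} → Normalizable A → A ≈ A
normalizable⇒≈-refl (C , a , nC) = C , a , a , nC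

lookup-subTs : ∀ {m k j} (σ : Fin m → Term k) (ts : Vec (Term m) j) (i : Fin j) →
  lookup (subTs σ ts) i ≡ subT σ (lookup ts i)
lookup-subTs σ (t ∷ ts) zero    = refl
lookup-subTs σ (t ∷ ts) (suc i) = lookup-subTs σ ts i

subTs-appAll : ∀ {m k j l} (σ : Fin m → Term k) (gs : Vec (PR j) l) (ts : Vec (Term m) j) →
  subTs σ (appAll gs ts) ≡ appAll gs (subTs σ ts)
subTs-appAll σ []       ts = refl
subTs-appAll σ (g ∷ gs) ts = cong (app g (subTs σ ts) ∷_) (subTs-appAll σ gs ts)

mutual
  subT-⟶T : ∀ {m k} (σ : Fin m → Term k) {t u} → t ⟶T u → subT σ t ⟶T subT σ u
  subT-⟶T σ (r-proj i ts) =
    subst (app (proj i) (subTs σ ts) ⟶T_) (lookup-subTs σ ts i) (r-proj i (subTs σ ts))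
  subT-⟶T σ (r-comp f gs ts) =
    subst (λ vs → app (comp f gs) (subTs σ ts) ⟶T app f vs) (sym (subTs-appAll σ gs ts))
      (r-comp f gs (subTs σ ts))
  subT-⟶T σ (r-rec0 g h ts)   = r-rec0 g h (subTs σ ts)
  subT-⟶T σ (r-recS g h t ts) = r-recS g h (subT σ t) (subTs σ ts)
  subT-⟶T σ (r-app f rs)      = r-app f (subTs-⟶Ts σ rs)

  subTs-⟶Ts : ∀ {m k j} (σ : Fin m → Term k) {ts us : Vec (Term m) j} →
    ts ⟶Ts us → subTs σ ts ⟶Ts subTs σ us
  subTs-⟶Ts σ (r-here r)   = r-here (subT-⟶T σ r)
  subTs-⟶Ts σ (r-there rs) = r-there (subTs-⟶Ts σ rs)

subF-⟶F : ∀ {m k} (σ : Fin m → Term k) {A B} → A ⟶F B → subF σ A ⟶F subF σ B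
subF-⟶F σ (r-≐l r) = r-≐l (subT-⟶T σ r)
subF-⟶F σ (r-≐r r) = r-≐r (subT-⟶T σ r)
subF-⟶F σ (r-∧l r) = r-∧l (subF-⟶F σ r)
subF-⟶F σ (r-∧r r) = r-∧r (subF-⟶F σ r)
subF-⟶F σ (r-∨l r) = r-∨l (subF-⟶F σ r)
subF-⟶F σ (r-∨r r) = r-∨r (subF-⟶F σ r)
subF-⟶F σ (r-⇒l r) = r-⇒l (subF-⟶F σ r)
subF-⟶F σ (r-⇒r r) = r-⇒r (subF-⟶F σ r)
subF-⟶F σ (r-∀ r)  = r-∀ (subF-⟶F (liftσ σ) r)
subF-⟶F σ (r-∃ r)  = r-∃ (subF-⟶F (liftσ σ) r)

data Head : Set where
  h≐ h⊥ h∧ h∨ h⇒ h∀ h∃ : Head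

head : ∀ {n} → Fm n → Head
head (_ ≐ _)  = h≐
head ⊥'       = h⊥
head (_ ∧' _) = h∧
head (_ ∨' _) = h∨
head (_ ⇒' _) = h⇒
head (∀' _)   = h∀
head (∃' _)   = h∃

head-⟶F : ∀ {n} {A B : Fm n} → A ⟶F B → head A ≡ head B
head-⟶F (r-≐l _) = refl
head-⟶F (r-≐r _) = refl
head-⟶F (r-∧l _) = refl
head-⟶F (r-∧r _) = refl
head-⟶F (r-∨l _) = refl
head-⟶F (r-∨r _) = refl
head-⟶F (r-⇒l _) = refl
head-⟶F (r-⇒r _) = refl
head-⟶F (r-∀ _)  = refl
head-⟶F (r-∃ _)  = refl

head-⟶F* : ∀ {n} {A B : Fm n} → A ⟶F* B → head A ≡ head B
head-⟶F* ε        = refl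
head-⟶F* (r ◅ rs) = trans (head-⟶F r) (head-⟶F* rs)

≈-head : ∀ {n} {A B : Fm n} → A ≈ B → head A ≡ head B
≈-head (_ , a , b , _) = trans (head-⟶F* a) (sym (head-⟶F* b))

AtomicHead : Head → Set
AtomicHead h≐ = ⊤
AtomicHead h⊥ = ⊤
AtomicHead _  = ⊥

atomic⇒AtomicHead : ∀ {n} {A : Fm n} → Atomic A → AtomicHead (head A)
atomic⇒AtomicHead at-eq  = _
atomic⇒AtomicHead at-bot = _

AtomicHead⇒atomic : ∀ {n} (A : Fm n) → AtomicHead (head A) → Atomic A
AtomicHead⇒atomic (_ ≐ _) _ = at-eq
AtomicHead⇒atomic ⊥'      _ = at-bot

≈-atomic : ∀ {n} {A B : Fm n} → A ≈ B → Atomic B → Atomic A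
≈-atomic {A = A} e a = AtomicHead⇒atomic A (subst AtomicHead (sym (≈-head e)) (atomic⇒AtomicHead a))

inst-atomic : ∀ {A : Fm 1} (t : Term 0) → Atomic A → Atomic (inst A t)
inst-atomic t at-eq  = at-eq
inst-atomic t at-bot = at-bot

head-∀ : ∀ {n} (A : Fm n) → head A ≡ h∀ → Σ (Fm (suc n)) λ P → A ≡ ∀' P
head-∀ (∀' P) refl = P , refl

⟶F*-∧ : ∀ {n} {A B X : Fm n} → (A ∧' B) ⟶F* X →
  Σ (Fm n) λ A' → Σ (Fm n) λ B' → X ≡ A' ∧' B' × A ⟶F* A' × B ⟶F* B'
⟶F*-∧ ε = _ , _ , refl , ε , ε
⟶F*-∧ (r-∧l r ◅ rs) with ⟶F*-∧ rs
... | A' , B' , refl , a , b = A' , B' , refl , r ◅ a , b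
⟶F*-∧ (r-∧r r ◅ rs) with ⟶F*-∧ rs
... | A' , B' , refl , a , b = A' , B' , refl , a , r ◅ b

⟶F*-∨ : ∀ {n} {A B X : Fm n} → (A ∨' B) ⟶F* X →
  Σ (Fm n) λ A' → Σ (Fm n) λ B' → X ≡ A' ∨' B' × A ⟶F* A' × B ⟶F* B'
⟶F*-∨ ε = _ , _ , refl , ε , ε
⟶F*-∨ (r-∨l r ◅ rs) with ⟶F*-∨ rs
... | A' , B' , refl , a , b = A' , B' , refl , r ◅ a , b
⟶F*-∨ (r-∨r r ◅ rs) with ⟶F*-∨ rs
... | A' , B' , refl , a , b = A' , B' , refl , a , r ◅ b

⟶F*-⇒ : ∀ {n} {A B X : Fm n} → (A ⇒' B) ⟶F* X →
  Σ (Fm n) λ A' → Σ (Fm n) λ B' → X ≡ (A' ⇒' B') × A ⟶F* A' × B ⟶F* B'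
⟶F*-⇒ ε = _ , _ , refl , ε , ε
⟶F*-⇒ (r-⇒l r ◅ rs) with ⟶F*-⇒ rs
... | A' , B' , refl , a , b = A' , B' , refl , r ◅ a , b
⟶F*-⇒ (r-⇒r r ◅ rs) with ⟶F*-⇒ rs
... | A' , B' , refl , a , b = A' , B' , refl , a , r ◅ b

⟶F*-∀ : ∀ {n} {A : Fm (suc n)} {X} → ∀' A ⟶F* X → Σ (Fm (suc n)) λ A' → X ≡ ∀' A' × A ⟶F* A'
⟶F*-∀ ε = _ , refl , ε
⟶F*-∀ (r-∀ r ◅ rs) with ⟶F*-∀ rs
... | A' , refl , a = A' , refl , r ◅ a

⟶F*-∃ : ∀ {n} {A : Fm (suc n)} {X} → ∃' A ⟶F* X → Σ (Fm (suc n)) λ A' → X ≡ ∃' A' × A ⟶F* A'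
⟶F*-∃ ε = _ , refl , ε
⟶F*-∃ (r-∃ r ◅ rs) with ⟶F*-∃ rs
... | A' , refl , a = A' , refl , r ◅ a

normalizable-∧ : ∀ {n} {A B : Fm n} → Normalizable (A ∧' B) → Normalizable A × Normalizable B
normalizable-∧ (_ , s , nC) with ⟶F*-∧ s
... | A' , B' , refl , a , b = (A' , a , λ _ → nC _ ∘ r-∧l) , (B' , b , λ _ → nC _ ∘ r-∧r)

normalizable-∨ : ∀ {n} {A B : Fm n} → Normalizable (A ∨' B) → Normalizable A × Normalizable B
normalizable-∨ (_ , s , nC) with ⟶F*-∨ s
... | A' , B' , refl , a , b = (A' , a , λ _ → nC _ ∘ r-∨l) , (B' , b , λ _ → nC _ ∘ r-∨r)

normalizable-⇒ : ∀ {n} {A B : Fm n} → Normalizable (A ⇒' B) → Normalizable A × Normalizable B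
normalizable-⇒ (_ , s , nC) with ⟶F*-⇒ s
... | A' , B' , refl , a , b = (A' , a , λ _ → nC _ ∘ r-⇒l) , (B' , b , λ _ → nC _ ∘ r-⇒r)

∀-injective-≈ : ∀ {n} {A B : Fm (suc n)} → ∀' A ≈ ∀' B → A ≈ B
∀-injective-≈ (_ , a , b , nC) with ⟶F*-∀ a | ⟶F*-∀ b
... | C , refl , a' | _ , refl , b' = C , a' , b' , λ _ → nC _ ∘ r-∀

∃-injective-≈ : ∀ {n} {A B : Fm (suc n)} → ∃' A ≈ ∃' B → A ≈ B
∃-injective-≈ (_ , a , b , nC) with ⟶F*-∃ a | ⟶F*-∃ b
... | C , refl , a' | _ , refl , b' = C , a' , b' , λ _ → nC _ ∘ r-∃

≈-simplyUniversal : ∀ {A B} → SimplyUniversal A → A ≈ B → SimplyUniversal B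
≈-simplyUniversal {B = B} (P , aP , refl) e with head-∀ B (sym (≈-head e))
... | Q , refl = Q , ≈-atomic (≈-sym (∀-injective-≈ e)) aP , refl

simplyUniversal-not-atomic : ∀ {A} → SimplyUniversal A → ¬ Atomic A
simplyUniversal-not-atomic (_ , _ , refl) ()

simplyUniversal-not-simple : ∀ {A} → SimplyUniversal A → ¬ (Atomic A ⊎ SimplyExistential A)
simplyUniversal-not-simple (_ , _ , refl) (inj₂ (_ , _ , ()))

⊑-⟶F : ∀ {B X X'} → B ⊑ X → X ⟶F X' → B ⊑ X'
⊑-⟶F (⊑-refl (C , b , x , nC)) r = ⊑-refl (C , b , reduct-reaches-normal nC x (r ◅ ε) , nC)
⊑-⟶F (⊑-∧l p)   (r-∧l r) = ⊑-∧l (⊑-⟶F p r)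
⊑-⟶F (⊑-∧l p)   (r-∧r r) = ⊑-∧l p
⊑-⟶F (⊑-∧r p)   (r-∧l r) = ⊑-∧r p
⊑-⟶F (⊑-∧r p)   (r-∧r r) = ⊑-∧r (⊑-⟶F p r)
⊑-⟶F (⊑-∨l p)   (r-∨l r) = ⊑-∨l (⊑-⟶F p r)
⊑-⟶F (⊑-∨l p)   (r-∨r r) = ⊑-∨l p
⊑-⟶F (⊑-∨r p)   (r-∨l r) = ⊑-∨r p
⊑-⟶F (⊑-∨r p)   (r-∨r r) = ⊑-∨r (⊑-⟶F p r)
⊑-⟶F (⊑-⇒l p)   (r-⇒l r) = ⊑-⇒l (⊑-⟶F p r)
⊑-⟶F (⊑-⇒l p)   (r-⇒r r) = ⊑-⇒l p
⊑-⟶F (⊑-⇒r p)   (r-⇒l r) = ⊑-⇒r p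
⊑-⟶F (⊑-⇒r p)   (r-⇒r r) = ⊑-⇒r (⊑-⟶F p r)
⊑-⟶F (⊑-∀ t p)  (r-∀ r)  = ⊑-∀ t (⊑-⟶F p (subF-⟶F _ r))
⊑-⟶F (⊑-∃ t p)  (r-∃ r)  = ⊑-∃ t (⊑-⟶F p (subF-⟶F _ r))

⊑-⟵F : ∀ {B X X'} → B ⊑ X' → X ⟶F X' → B ⊑ X
⊑-⟵F (⊑-refl (C , b , x , nC)) r = ⊑-refl (C , b , r ◅ x , nC)
⊑-⟵F (⊑-∧l p)   (r-∧l r) = ⊑-∧l (⊑-⟵F p r)
⊑-⟵F (⊑-∧l p)   (r-∧r r) = ⊑-∧l p
⊑-⟵F (⊑-∧r p)   (r-∧l r) = ⊑-∧r p
⊑-⟵F (⊑-∧r p)   (r-∧r r) = ⊑-∧r (⊑-⟵F p r)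
⊑-⟵F (⊑-∨l p)   (r-∨l r) = ⊑-∨l (⊑-⟵F p r)
⊑-⟵F (⊑-∨l p)   (r-∨r r) = ⊑-∨l p
⊑-⟵F (⊑-∨r p)   (r-∨l r) = ⊑-∨r p
⊑-⟵F (⊑-∨r p)   (r-∨r r) = ⊑-∨r (⊑-⟵F p r)
⊑-⟵F (⊑-⇒l p)   (r-⇒l r) = ⊑-⇒l (⊑-⟵F p r)
⊑-⟵F (⊑-⇒l p)   (r-⇒r r) = ⊑-⇒l p
⊑-⟵F (⊑-⇒r p)   (r-⇒l r) = ⊑-⇒r p
⊑-⟵F (⊑-⇒r p)   (r-⇒r r) = ⊑-⇒r (⊑-⟵F p r)
⊑-⟵F (⊑-∀ t p)  (r-∀ r)  = ⊑-∀ t (⊑-⟵F p (subF-⟶F _ r))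
⊑-⟵F (⊑-∃ t p)  (r-∃ r)  = ⊑-∃ t (⊑-⟵F p (subF-⟶F _ r))

⊑-⟶F* : ∀ {B X X'} → B ⊑ X → X ⟶F* X' → B ⊑ X'
⊑-⟶F* p ε        = p
⊑-⟶F* p (r ◅ rs) = ⊑-⟶F* (⊑-⟶F p r) rs

⊑-⟵F* : ∀ {B X X'} → B ⊑ X' → X ⟶F* X' → B ⊑ X
⊑-⟵F* p ε        = p
⊑-⟵F* p (r ◅ rs) = ⊑-⟵F (⊑-⟵F* p rs) r

⊑-≈ : ∀ {B X Y} → B ⊑ X → X ≈ Y → B ⊑ Y
⊑-≈ p (_ , x , y , _) = ⊑-⟵F* (⊑-⟶F* p x) y

⊑-trans : ∀ {B A C} → B ⊑ A → A ⊑ C → B ⊑ C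
⊑-trans p (⊑-refl e) = ⊑-≈ p e
⊑-trans p (⊑-∧l q)   = ⊑-∧l (⊑-trans p q)
⊑-trans p (⊑-∧r q)   = ⊑-∧r (⊑-trans p q)
⊑-trans p (⊑-∨l q)   = ⊑-∨l (⊑-trans p q)
⊑-trans p (⊑-∨r q)   = ⊑-∨r (⊑-trans p q)
⊑-trans p (⊑-⇒l q)   = ⊑-⇒l (⊑-trans p q)
⊑-trans p (⊑-⇒r q)   = ⊑-⇒r (⊑-trans p q)
⊑-trans p (⊑-∀ t q)  = ⊑-∀ t (⊑-trans p q)
⊑-trans p (⊑-∃ t q)  = ⊑-∃ t (⊑-trans p q)

∧-components-⊑ : ∀ {F A B} → F ≈ A ∧' B → A ⊑ F × B ⊑ F
∧-components-⊑ e with normalizable-∧ (≈-normalizableʳ e)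
... | nA , nB = ⊑-≈ (⊑-∧l (⊑-refl (normalizable⇒≈-refl nA))) (≈-sym e)
              , ⊑-≈ (⊑-∧r (⊑-refl (normalizable⇒≈-refl nB))) (≈-sym e)

∨-components-⊑ : ∀ {F A B} → F ≈ A ∨' B → A ⊑ F × B ⊑ F
∨-components-⊑ e with normalizable-∨ (≈-normalizableʳ e)
... | nA , nB = ⊑-≈ (⊑-∨l (⊑-refl (normalizable⇒≈-refl nA))) (≈-sym e)
              , ⊑-≈ (⊑-∨r (⊑-refl (normalizable⇒≈-refl nB))) (≈-sym e)

⇒-components-⊑ : ∀ {F A B} → F ≈ A ⇒' B → A ⊑ F × B ⊑ F
⇒-components-⊑ e with normalizable-⇒ (≈-normalizableʳ e)
... | nA , nB = ⊑-≈ (⊑-⇒l (⊑-refl (normalizable⇒≈-refl nA))) (≈-sym e)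
              , ⊑-≈ (⊑-⇒r (⊑-refl (normalizable⇒≈-refl nB))) (≈-sym e)

⊑-atomic : ∀ {B A} → B ⊑ A → Atomic A → Atomic B
⊑-atomic (⊑-refl e) a = ≈-atomic e a

⊑-simple-non-atomic : ∀ {B A} → B ⊑ A → Atomic A ⊎ SimplyExistential A → ¬ Atomic B →
  Σ (Fm 1) λ P → Atomic P × B ≈ ∃' P
⊑-simple-non-atomic p (inj₁ a) ¬a = ⊥-elim (¬a (⊑-atomic p a))
⊑-simple-non-atomic (⊑-refl e) (inj₂ (P , aP , refl)) _ = P , aP , e
⊑-simple-non-atomic (⊑-∃ t p) (inj₂ (P , aP , refl)) ¬a = ⊥-elim (¬a (⊑-atomic p (inst-atomic t aP)))

-- the connective introduced or eliminated by a rule (junk h⊥ for the other rules)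
connective : Tag → Head
connective andI      = h∧
connective andE₁     = h∧
connective andE₂     = h∧
connective orI₁      = h∨
connective orI₂      = h∨
connective (orE _ _) = h∨
connective (impI _)  = h⇒
connective impE      = h⇒
connective (allI _)  = h∀
connective allE      = h∀
connective exI       = h∃
connective (exE _ _) = h∃
connective _         = h⊥

intro-connective-not-atomic : ∀ {τ} → IsIntro τ → ¬ AtomicHead (connective τ)
intro-connective-not-atomic {andI} _ ()

intro-connective-∃ : ∀ {τ} → IsIntro τ → connective τ ≡ h∃ → τ ≡ exI
intro-connective-∃ {exI} _ _ = refl

elim-connective-∀ : ∀ {τ} → IsElim τ → connective τ ≡ h∀ → τ ≡ allE
elim-connective-∀ {allE} _ _ = refl

intro-not-elim : ∀ {τ} → IsIntro τ → ¬ IsElim τ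
intro-not-elim {andI}   _ ()
intro-not-elim {orI₁}   _ ()
intro-not-elim {orI₂}   _ ()
intro-not-elim {impI _} _ ()
intro-not-elim {allI _} _ ()
intro-not-elim {exI}    _ ()

intro-not-atomicRule : ∀ {τ} → IsIntro τ → ¬ IsAtomicRule τ
intro-not-atomicRule {atomT} ()

intro-not-em1 : ∀ {τ} → IsIntro τ → ¬ IsEM1 τ
intro-not-em1 {em1 _ _ _} ()

atomicRule-binds-nothing : ∀ {τ k x} → IsAtomicRule τ → ¬ Binds τ k x
atomicRule-binds-nothing {atomT} _ ()

binds-major⇒allI : ∀ {τ x} → Binds τ 0 x → τ ≡ allI x
binds-major⇒allI {allI _} refl = refl

intro-binds⇒allI : ∀ {τ k x} → IsIntro τ → Binds τ k x → τ ≡ allI x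
intro-binds⇒allI {allI _} {zero} _ refl = refl

premiss : ∀ {P : Der → Set} {k F τ ds e} → ChildAt k (node F τ ds) e → All P ds → P e
premiss c-here      (p ∷ _)  = p
premiss (c-there c) (_ ∷ ps) = premiss c ps

module RuleInstances (R : AtomicRules) where

  premiss-valid : ∀ {k d e} → ChildAt k d e → Valid R d → Valid R e
  premiss-valid c (valid vs _) = premiss c vs

  atomicRule-premiss-atomic : ∀ {k d e} → ChildAt k d e → Valid R d → IsAtomicRule (tag d) →
    Atomic (concl e)
  atomicRule-premiss-atomic {d = node F atomT ds} c (valid _ (Ps , C , r , _ , ds≈Ps)) _ =
    pointwise-atomic c ds≈Ps (proj₁ (AtomicRules.atomic R Ps C r))
    where
    pointwise-atomic : ∀ {k F ds e Ps} → ChildAt k (node F atomT ds) e →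
      Pointwise _≈_ (List.map concl ds) Ps → All Atomic Ps → Atomic (concl e)
    pointwise-atomic c-here      (e ∷ _)  (a ∷ _)  = ≈-atomic e a
    pointwise-atomic (c-there c) (_ ∷ es) (_ ∷ as) = pointwise-atomic c es as

  em1-major-≈ : ∀ {d e} → ChildAt 0 d e → Valid R d → IsEM1 (tag d) → concl e ≈ concl d
  em1-major-≈ {node F (em1 _ _ _) (_ ∷ _ ∷ [])} c-here (valid _ (_ , _ , _ , _ , e , _)) _ = e

  em1-concl-normalizable : ∀ {d} → Valid R d → IsEM1 (tag d) → Normalizable (concl d)
  em1-concl-normalizable {node F (em1 _ _ _) (_ ∷ _ ∷ [])} (valid _ (_ , _ , _ , _ , e , _)) _ =
    ≈-normalizableʳ e

  intro-concl-head : ∀ {d} → Valid R d → IsIntro (tag d) →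
    Σ (Fm 0) λ X → concl d ≈ X × head X ≡ connective (tag d)
  intro-concl-head {node F andI     (_ ∷ _ ∷ [])} (valid _ e)             _ = _ , e , refl
  intro-concl-head {node F orI₁     (_ ∷ [])}     (valid _ (_ , e))       _ = _ , e , refl
  intro-concl-head {node F orI₂     (_ ∷ [])}     (valid _ (_ , e))       _ = _ , e , refl
  intro-concl-head {node F (impI _) (_ ∷ [])}     (valid _ (_ , e , _))   _ = _ , e , refl
  intro-concl-head {node F (allI _) (_ ∷ [])}     (valid _ (_ , e , _))   _ = _ , e , refl
  intro-concl-head {node F exI      (_ ∷ [])}     (valid _ (_ , _ , e , _)) _ = _ , e , refl

  intro-concl-not-atomic : ∀ {d} → Valid R d → IsIntro (tag d) → ¬ Atomic (concl d)
  intro-concl-not-atomic v ii a with intro-concl-head v ii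
  ... | _ , e , h = intro-connective-not-atomic ii
                      (subst AtomicHead (trans (≈-head e) h) (atomic⇒AtomicHead a))

  intro-concl-normalizable : ∀ {d} → Valid R d → IsIntro (tag d) → Normalizable (concl d)
  intro-concl-normalizable v ii = ≈-normalizableˡ (proj₁ (proj₂ (intro-concl-head v ii)))

  intro-premiss-⊑ : ∀ {k d e} → ChildAt k d e → Valid R d → IsIntro (tag d) → concl e ⊑ concl d
  intro-premiss-⊑ {d = node F andI (_ ∷ _ ∷ [])} c-here (valid _ e) _ = proj₁ (∧-components-⊑ e)
  intro-premiss-⊑ {d = node F andI (_ ∷ _ ∷ [])} (c-there c-here) (valid _ e) _ =
    proj₂ (∧-components-⊑ e)
  intro-premiss-⊑ {d = node F orI₁ (_ ∷ [])} c-here (valid _ (_ , e)) _ = proj₁ (∨-components-⊑ e)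
  intro-premiss-⊑ {d = node F orI₂ (_ ∷ [])} c-here (valid _ (_ , e)) _ = proj₂ (∨-components-⊑ e)
  intro-premiss-⊑ {d = node F (impI _) (_ ∷ [])} c-here (valid _ (_ , e , _)) _ =
    proj₂ (⇒-components-⊑ e)
  intro-premiss-⊑ {d = node F (allI x) (_ ∷ [])} c-here (valid _ (_ , e , eᵢ , _)) _ =
    ⊑-≈ (⊑-∀ (var x) (⊑-refl eᵢ)) (≈-sym e)
  intro-premiss-⊑ {d = node F exI (_ ∷ [])} c-here (valid _ (_ , t , e , eᵢ)) _ =
    ⊑-≈ (⊑-∃ t (⊑-refl eᵢ)) (≈-sym e)

  exI-premiss-atomic : ∀ {k F ds e P} → ChildAt k (node F exI ds) e → Valid R (node F exI ds) →
    F ≈ ∃' P → Atomic P → Atomic (concl e)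
  exI-premiss-atomic {ds = _ ∷ []} c-here (valid _ (_ , t , e , eᵢ)) eP aP =
    ≈-atomic eᵢ (inst-atomic t (≈-atomic (∃-injective-≈ (≈-trans (≈-sym e) eP)) aP))

  intro-∃-concl : ∀ {k d e P} → ChildAt k d e → Valid R d → IsIntro (tag d) →
    concl d ≈ ∃' P → Atomic P → tag d ≡ exI × Atomic (concl e)
  intro-∃-concl {d = node F τ ds} c v ii eP aP with intro-concl-head v ii
  ... | _ , e , h with intro-connective-∃ ii (trans (sym h) (trans (sym (≈-head e)) (≈-head eP)))
  ... | refl = refl , exI-premiss-atomic c v eP aP

  elim-major-head : ∀ {d e} → ChildAt 0 d e → Valid R d → IsElim (tag d) →
    Σ (Fm 0) λ X → concl e ≈ X × head X ≡ connective (tag d)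
  elim-major-head {node F andE₁     (_ ∷ [])}         c-here (valid _ (_ , e))     _ = _ , e , refl
  elim-major-head {node F andE₂     (_ ∷ [])}         c-here (valid _ (_ , e))     _ = _ , e , refl
  elim-major-head {node F (orE _ _) (_ ∷ _ ∷ _ ∷ [])} c-here (valid _ (_ , _ , e , _)) _ = _ , e , refl
  elim-major-head {node F impE      (_ ∷ _ ∷ [])}     c-here (valid _ e)           _ = _ , e , refl
  elim-major-head {node F allE      (_ ∷ [])}         c-here (valid _ (_ , _ , e , _)) _ = _ , e , refl
  elim-major-head {node F (exE _ _) (_ ∷ _ ∷ [])}     c-here (valid _ (_ , e , _)) _ = _ , e , refl

  allE-concl-atomic : ∀ {F ds e P} → ChildAt 0 (node F allE ds) e → Valid R (node F allE ds) →
    concl e ≡ ∀' P → Atomic P → Atomic F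
  allE-concl-atomic {ds = _ ∷ []} c-here (valid _ (_ , t , e , eᵢ)) eq aP =
    ≈-atomic eᵢ (inst-atomic t (≈-atomic (≈-sym (∀-injective-≈ (subst (_≈ _) eq e))) aP))

  elim-∀-major : ∀ {d e P} → ChildAt 0 d e → Valid R d → IsElim (tag d) →
    concl e ≡ ∀' P → Atomic P → tag d ≡ allE × Atomic (concl d)
  elim-∀-major {node F τ ds} c v el eq aP with elim-major-head c v el
  ... | _ , e , h with elim-connective-∀ el (trans (sym h) (trans (sym (≈-head e)) (cong head eq)))
  ... | refl = refl , allE-concl-atomic c v eq aP

downward-induction : ∀ (P : ℕ → Set) {n} → P n → (∀ j → j < n → P (suc j) → P j) →
  ∀ {j} → j ≤‴ n → P j
downward-induction P base step ≤‴-refl       = base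
downward-induction P base step (≤‴-step j<n) = step _ (≤‴⇒≤ j<n) (downward-induction P base step j<n)

upward-induction : ∀ (P : ℕ → Set) {i n} → P i → (∀ j → i ≤ j → j < n → P j → P (suc j)) →
  ∀ {j} → i ≤′ j → j ≤ n → P j
upward-induction P base step ≤′-refl        _    = base
upward-induction P base step (≤′-step i≤′j) j<n =
  step _ (≤′⇒≤ i≤′j) j<n (upward-induction P base step i≤′j (<⇒≤ j<n))

module OpenNormalBranch (R : AtomicRules) {Π : Der} (valid-Π : Valid R Π)
  (b : Branch Π) (principal : Principal b)
  (nE nA nI : ℕ) (onf : OpenNormalForm b nE nA nI) where

  open RuleInstances R

  n m : ℕ
  n = len b
  m = nE + nA

  -- the rule instance with premiss a_j and conclusion a_(j+1)
  rule : ℕ → Tag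
  rule j = tag (occ b (suc j))

  private
    lengths : nE + nA + nI ≡ n
    lengths = proj₁ onf

    starts-open : OpenAssumption b
    starts-open = proj₁ (proj₂ onf)

    elim-part : ∀ i → 0 < i → i ≤ nE → IsElim (tag (occ b i))
    elim-part = proj₁ (proj₂ (proj₂ onf))

    atomic-part : ∀ i → nE < i → i ≤ m → IsAtomicRule (tag (occ b i)) ⊎ IsEM1 (tag (occ b i))
    atomic-part = proj₁ (proj₂ (proj₂ (proj₂ onf)))

    first-intro : suc m ≤ n → IsIntro (tag (occ b (suc m)))
    first-intro = proj₁ (proj₂ (proj₂ (proj₂ (proj₂ onf))))

    intro-part : ∀ i → m < i → i ≤ n → IsIntro (tag (occ b i)) ⊎ IsEM1 (tag (occ b i))
    intro-part = proj₂ (proj₂ (proj₂ (proj₂ (proj₂ onf))))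

  nE≤n : nE ≤ n
  nE≤n = subst (nE ≤_) lengths (≤-trans (m≤m+n nE nA) (m≤m+n m nI))

  valid-occ : ∀ j → j ≤ n → Valid R (occ b j)
  valid-occ j j≤n =
    downward-induction (Valid R ∘ occ b) (subst (Valid R) (sym (root b)) valid-Π)
      (λ j j<n → premiss-valid (link b j j<n)) (≤⇒≤‴ j≤n)

  major : ∀ j → j < n → IsElim (rule j) ⊎ IsEM1 (rule j) → ChildAt 0 (occ b (suc j)) (occ b j)
  major j j<n c = subst (λ k → ChildAt k (occ b (suc j)) (occ b j)) (principal j j<n c) (link b j j<n)

  major-binder : ∀ j x → j < n → IsElim (rule j) ⊎ IsEM1 (rule j) →
    Binds (rule j) (idx b j) x → rule j ≡ allI x
  major-binder j x j<n c = binds-major⇒allI ∘ subst (λ k → Binds (rule j) k x) (principal j j<n c)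

  em1-≈ : ∀ j → j < n → IsEM1 (rule j) → fml b j ≈ fml b (suc j)
  em1-≈ j j<n em = em1-major-≈ (major j j<n (inj₂ em)) (valid-occ (suc j) j<n) em

  data Inference (j : ℕ) : Set where
    by-elim   : j < nE → IsElim (rule j) → Inference j
    by-atomic : IsAtomicRule (rule j) → Inference j
    by-em1    : IsEM1 (rule j) → Inference j
    by-intro  : m < suc j → IsIntro (rule j) → Inference j

  inference : ∀ j → j < n → Inference j
  inference j j<n with suc j ≤? nE
  ... | yes j<nE = by-elim j<nE (elim-part (suc j) (s≤s z≤n) j<nE)
  ... | no j≮nE with suc j ≤? m
  ... | yes j<m  = [ by-atomic , by-em1 ]′ (atomic-part (suc j) (≰⇒> j≮nE) j<m)
  ... | no j≮m   = [ by-intro (≰⇒> j≮m) , by-em1 ]′ (intro-part (suc j) (≰⇒> j≮m) j<n)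

  intro-region-not-atomic : ∀ i → m < i → i ≤ n → ¬ Atomic (fml b i)
  intro-region-not-atomic i m<i i≤n =
    upward-induction (λ j → ¬ Atomic (fml b j)) first step (≤⇒≤′ m<i) i≤n
    where
    m<n : m < n
    m<n = ≤-trans m<i i≤n

    first : ¬ Atomic (fml b (suc m))
    first = intro-concl-not-atomic (valid-occ (suc m) m<n) (first-intro m<n)

    step : ∀ j → m < j → j < n → ¬ Atomic (fml b j) → ¬ Atomic (fml b (suc j))
    step j m<j j<n ¬atomic with intro-part (suc j) (m<n⇒m<1+n m<j) j<n
    ... | inj₁ ii = intro-concl-not-atomic (valid-occ (suc j) j<n) ii
    ... | inj₂ em = ¬atomic ∘ ≈-atomic (em1-≈ j j<n em)

  last-normalizable : m < n → Normalizable (fml b n)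
  last-normalizable m<n with intro-part n m<n ≤-refl
  ... | inj₁ ii = intro-concl-normalizable (valid-occ n ≤-refl) ii
  ... | inj₂ em = em1-concl-normalizable (valid-occ n ≤-refl) em

  intro-region-⊑ : ∀ i → m < i → i ≤ n → fml b i ⊑ fml b n
  intro-region-⊑ i m<i i≤n =
    downward-induction (λ j → m < j → fml b j ⊑ fml b n)
      (⊑-refl ∘ normalizable⇒≈-refl ∘ last-normalizable) step (≤⇒≤‴ i≤n) m<i
    where
    step : ∀ j → j < n → (m < suc j → fml b (suc j) ⊑ fml b n) → m < j → fml b j ⊑ fml b n
    step j j<n ih m<j with intro-part (suc j) (m<n⇒m<1+n m<j) j<n
    ... | inj₁ ii = ⊑-trans (intro-premiss-⊑ (link b j j<n) (valid-occ (suc j) j<n) ii)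
                            (ih (m<n⇒m<1+n m<j))
    ... | inj₂ em = ⊑-trans (⊑-refl (em1-≈ j j<n em)) (ih (m<n⇒m<1+n m<j))

  intro-⊑ : ∀ i → i ≤ n → IsIntro (tag (occ b i)) → fml b i ⊑ fml b n
  intro-⊑ zero _ ii =
    ⊥-elim (subst (IsIntro ∘ tag) (proj₁ (proj₂ (proj₂ starts-open))) ii)
  intro-⊑ (suc j) i≤n ii with inference j i≤n
  ... | by-elim _ el  = ⊥-elim (intro-not-elim ii el)
  ... | by-atomic at  = ⊥-elim (intro-not-atomicRule ii at)
  ... | by-em1 em     = ⊥-elim (intro-not-em1 ii em)
  ... | by-intro m<i _ = intro-region-⊑ (suc j) m<i i≤n

  module _ (simple : Simple (fml b n)) where

    intro-region-exI : ∀ j → m < suc j → j < n → IsIntro (rule j) →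
      rule j ≡ exI × Atomic (fml b j)
    intro-region-exI j m<j j<n ii
      with ⊑-simple-non-atomic (intro-region-⊑ (suc j) m<j j<n) (proj₂ simple)
                               (intro-region-not-atomic (suc j) m<j j<n)
    ... | P , aP , e = intro-∃-concl (link b j j<n) (valid-occ (suc j) j<n) ii e aP

    no-binder : ∀ j x → j < n → ¬ Binds (rule j) (idx b j) x
    no-binder j x j<n bd with inference j j<n
    ... | by-elim _ el = subst IsElim (major-binder j x j<n (inj₁ el) bd) el
    ... | by-atomic at = atomicRule-binds-nothing at bd
    ... | by-em1 em    = subst IsEM1 (major-binder j x j<n (inj₂ em) bd) em
    ... | by-intro m<j ii
      with trans (sym (intro-binds⇒allI ii bd)) (proj₁ (intro-region-exI j m<j j<n ii))
    ...   | ()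

    free-in-Π : ∀ i x → i ≤ n → OccF x (fml b i) → FreeIn x Π
    free-in-Π i x i≤n x∈Aᵢ = subst (FreeIn x) (root b)
      (upward-induction (FreeIn x ∘ occ b) (fi-here x∈Aᵢ)
        (λ j _ j<n x∈aⱼ → fi-there (link b j j<n) x∈aⱼ (no-binder j x j<n))
        (≤⇒≤′ i≤n) ≤-refl)

    not-simplyUniversal : ∀ i → nE ≤ i → i ≤ n → ¬ SimplyUniversal (fml b i)
    not-simplyUniversal i nE≤i i≤n =
      downward-induction (λ j → nE ≤ j → ¬ SimplyUniversal (fml b j))
        (λ _ su → simplyUniversal-not-simple su (proj₂ simple)) step (≤⇒≤‴ i≤n) nE≤i
      where
      step : ∀ j → j < n → (nE ≤ suc j → ¬ SimplyUniversal (fml b (suc j))) →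
        nE ≤ j → ¬ SimplyUniversal (fml b j)
      step j j<n ih nE≤j su with inference j j<n
      ... | by-elim j<nE _ = ≤⇒≯ nE≤j j<nE
      ... | by-atomic at   = simplyUniversal-not-atomic su
                               (atomicRule-premiss-atomic (link b j j<n) (valid-occ (suc j) j<n) at)
      ... | by-em1 em      = ih (m≤n⇒m≤1+n nE≤j) (≈-simplyUniversal su (em1-≈ j j<n em))
      ... | by-intro m<j ii = simplyUniversal-not-atomic su (proj₂ (intro-region-exI j m<j j<n ii))

    simplyUniversal⇒allE : ∀ i → i ≤ n → SimplyUniversal (fml b i) →
      i < n × rule i ≡ allE × Atomic (fml b (suc i))
    simplyUniversal⇒allE i i≤n su with nE ≤? i
    ... | yes nE≤i = ⊥-elim (not-simplyUniversal i nE≤i i≤n su)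
    ... | no nE≰i = elim-region (≰⇒> nE≰i) su
      where
      elim-region : i < nE → SimplyUniversal (fml b i) → i < n × rule i ≡ allE × Atomic (fml b (suc i))
      elim-region i<nE (P , aP , eq) =
        i<n , elim-∀-major (major i i<n (inj₁ el)) (valid-occ (suc i) i<n) el eq aP
        where
        i<n = <-≤-trans i<nE nE≤n
        el  = elim-part (suc i) (s≤s z≤n) i<nE

lemma1 : (R : AtomicRules) (Π : Der) → Valid R Π →
    (b : Branch Π) → Principal b →
    (nE nA nI : ℕ) → OpenNormalForm b nE nA nI →
    -- (1)
    (∀ i → nE + nA < i → i ≤ len b →
       ¬ Atomic (fml b i) × (fml b i ⊑ fml b (len b)))
    -- (2)
    × (∀ i → i ≤ len b → IsIntro (tag (occ b i)) → fml b i ⊑ fml b (len b))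
    × (Simple (fml b (len b)) →
      -- (3)
      (∀ i x → i ≤ len b → OccF x (fml b i) → FreeIn x Π)
      -- (4)
      × (∀ i → i ≤ len b → SimplyUniversal (fml b i) →
           i < len b × tag (occ b (suc i)) ≡ allE)
      -- (5)
      × ((∀ x → ¬ FreeIn x Π) → ∀ i → i ≤ len b → SimplyUniversal (fml b i) →
           i < len b × Atomic (fml b (suc i)) × Closed (fml b (suc i))))
lemma1 R Π valid-Π b principal nE nA nI onf =
  (λ i m<i i≤n → intro-region-not-atomic i m<i i≤n , intro-region-⊑ i m<i i≤n) ,
  intro-⊑ ,
  λ simple →
    free-in-Π simple ,
    (λ i i≤n su → let (i<n , is-allE , _) = simplyUniversal⇒allE simple i i≤n su in i<n , is-allE) ,
    (λ no-free i i≤n su →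
      let (i<n , _ , atomic) = simplyUniversal⇒allE simple i i≤n su
      in i<n , atomic , λ x x∈A → no-free x (free-in-Π simple (suc i) x i<n x∈A))
  where open OpenNormalBranch R valid-Π b principal nE nA nI onf
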